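{- Let $G,H$ be finite simple connected graphs, fix a root $(r_G,r_H)\in V(G\,\square\,H)$, and let $K\in\{G,H\}$ with $\bar K$ the other graph; write $r_{\bar K}$ for the $\bar K$-coordinate of the root. Then every configuration $c$ on $G\,\square\,H$ from which no sequence of pebbling moves places a pebble on $(r_G,r_H)$ satisfies \[ \Bigl(\sum_{j\in V(\bar K)\setminus\{r_{\bar K}\}} stack_{K,j,D_{\bar K}(j,r_{\bar K})}\Bigr)+\tilde c_{K,r_{\bar K}}+1\ \le\ \pi(K). \]
   Context: The Cartesian product $G\,\square\,H$ has vertex set $V(G)\times V(H)$, with $(g,h)\sim(g',h')$ iff ($g=g'$ and $h\sim_H h'$) or ($h=h'$ and $g\sim_G g'$). $D_X$ is graph distance in $X$. A configuration is a function $c:V(G\,\square\,H)\to\mathbb{Z}_{\ge0}$. A pebbling move removes two pebbles from a vertex and adds one to an adjacent vertex. $\pi(X)$ (pebbling number) is the least $k$ such that from every configuration of size $k$ on $X$ and every root some sequence of pebbling moves places a pebble on the root. For $K\in\{G,H\}$, $\bar K$ is the other graph; for $j\in V(\bar K)$ the $K$-slice $K_j$ is $\{(i,j):i\in V(G)\}$ if $K=G$ and $\{(j,h):h\in V(H)\}$ if $K=H$. For a configuration $c$: $\tilde c_{K,j}=\sum_{u\in K_j}c(u)$, and $stack_{K,j,d}$ is the number of (disjoint) $2^d$-stacks in $K_j$, where a $2^d$-stack is a collection of $2^d$ pebbles on a single vertex, i.e. $stack_{K,j,d}=\sum_{u\in K_j}\lfloor c(u)/2^d\rfloor$. -}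

module Defs where

open import Data.Nat using (ℕ; zero; suc; _+_; _^_; _≤_; _/_)
open import Data.Nat.Properties using (m^n≢0)
open import Data.Fin using (Fin; zero; suc; _≟_)
open import Data.Bool using (Bool; true; false; T; if_then_else_)
open import Data.Product using (_×_; _,_; ∃; ∃-syntax; Σ-syntax)
open import Data.Sum using (_⊎_)
open import Relation.Nullary using (¬_; does)
open import Relation.Binary using (DecidableEquality)
open import Relation.Binary.PropositionalEquality using (_≡_)
open import Relation.Binary.Construct.Closure.ReflexiveTransitive using (Star)

record Graph : Set where
  field
    n      : ℕ
    adj    : Fin n → Fin n → Bool
    sym    : ∀ u v → adj u v ≡ adj v u
    irrefl : ∀ u → adj u u ≡ false

open Graph public

V : Graph → Set
V G = Fin (n G)

Adj : (G : Graph) → V G → V G → Set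
Adj G u v = T (adj G u v)

data Walk (G : Graph) : V G → V G → ℕ → Set where
  here : ∀ {u} → Walk G u u zero
  step : ∀ {u w v k} → Adj G u w → Walk G w v k → Walk G u v (suc k)

Connected : Graph → Set
Connected G = ∀ u v → ∃[ k ] Walk G u v k

IsDistance : (G : Graph) → V G → V G → ℕ → Set
IsDistance G u v d = Walk G u v d × (∀ k → Walk G u v k → d ≤ k)

sumFin : (m : ℕ) → (Fin m → ℕ) → ℕ
sumFin zero    f = 0
sumFin (suc m) f = f zero + sumFin m (λ i → f (suc i))

Config : Set → Set
Config X = X → ℕ

-- one pebbling move: remove two pebbles from u, add one to an adjacent v
Move : {X : Set} → DecidableEquality X → (X → X → Set) →
       Config X → Config X → Set
Move {X} _≟X_ A c c' =
  Σ[ u ∈ X ] Σ[ v ∈ X ] (A u v × 2 ≤ c u ×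
    (∀ w → c' w + (if does (w ≟X u) then 2 else 0)
         ≡ c w + (if does (w ≟X v) then 1 else 0)))

Solvable : {X : Set} → DecidableEquality X → (X → X → Set) →
           Config X → X → Set
Solvable _≟X_ A c r = ∃[ c' ] (Star (Move _≟X_ A) c c' × 1 ≤ c' r)

size : (G : Graph) → Config (V G) → ℕ
size G c = sumFin (n G) c

SolvableG : (G : Graph) → Config (V G) → V G → Set
SolvableG G = Solvable _≟_ (Adj G)

Pebbles : Graph → ℕ → Set
Pebbles G k = ∀ (c : Config (V G)) → size G c ≡ k → ∀ r → SolvableG G c r

IsPebblingNumber : Graph → ℕ → Set
IsPebblingNumber G p = Pebbles G p × (∀ k → Pebbles G k → p ≤ k)

_≟×_ : (G H : Graph) → DecidableEquality (V G × V H)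
(G ≟× H) (g , h) (g' , h') with g ≟ g' | h ≟ h'
... | Relation.Nullary.yes Relation.Binary.PropositionalEquality.refl
    | Relation.Nullary.yes Relation.Binary.PropositionalEquality.refl =
      Relation.Nullary.yes Relation.Binary.PropositionalEquality.refl
... | Relation.Nullary.no ¬p | _ =
      Relation.Nullary.no (λ { Relation.Binary.PropositionalEquality.refl →
                                ¬p Relation.Binary.PropositionalEquality.refl })
... | Relation.Nullary.yes _ | Relation.Nullary.no ¬q =
      Relation.Nullary.no (λ { Relation.Binary.PropositionalEquality.refl →
                                ¬q Relation.Binary.PropositionalEquality.refl })

AdjProd : (G H : Graph) → V G × V H → V G × V H → Set
AdjProd G H (g , h) (g' , h') =
  (g ≡ g' × Adj H h h') ⊎ (h ≡ h' × Adj G g g')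

SolvableProd : (G H : Graph) → Config (V G × V H) → V G × V H → Set
SolvableProd G H = Solvable (G ≟× H) (AdjProd G H)

sliceG : (G H : Graph) → Config (V G × V H) → V H → Config (V G)
sliceG G H c j i = c (i , j)

sliceH : (G H : Graph) → Config (V G × V H) → V G → Config (V H)
sliceH G H c j h = c (j , h)

stack : (K : Graph) → Config (V K) → ℕ → ℕ
stack K s d = sumFin (n K) (λ u → _/_ (s u) (2 ^ d) {{m^n≢0 2 d}})

tot : (K : Graph) → Config (V K) → ℕ
tot K s = sumFin (n K) s

Bound : (K Kb : Graph) → (V Kb → Config (V K)) → V Kb → (V Kb → ℕ) → ℕ → Set
Bound K Kb s rb dist p =
  sumFin (n Kb) (λ j → if does (j ≟ rb) then 0 else stack K (s j) (dist j))
    + tot K (s rb) + 1 ≤ p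

{-# OPTIONS --safe #-}
-- Pebbling is monotone and additive: if c can be moved to dominate e₁ and c′ to dominate e₂,
-- then c + c′ can be moved to dominate e₁ + e₂. Sliding each pebble pile of the slice K_j along
-- a shortest walk of length d to the root slice K_r halves it at every step, so the whole of c
-- can be moved onto K_r, arriving there as a configuration of size
-- Σ_{j ≠ r} stack_{K,j,d(j)} + c̃_{K,r}. If that size reached π(K), a solution in K, copied
-- into the slice K_r, would reach the root. The case K = H is the case K = G in H □ G.
module Submission where

open import Defs hiding (sym)
open import Data.Bool using (true; false; if_then_else_)
open import Data.Fin using (Fin; zero; suc; _≟_)
open import Data.Fin.Properties using (suc-injective)
open import Data.Nat using (ℕ; zero; suc; _+_; _*_; _∸_; _^_; _⊓_; _≤_; _/_; z≤n)
open import Data.Nat.DivMod using (m/n*n≤m; m/n/o≡m/[n*o]; n/1≡n)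
open import Data.Nat.Properties
  using (+-0-commutativeMonoid; +-commutativeSemigroup; +-comm; +-assoc; +-identityʳ; +-monoˡ-≤;
         ≤-refl; ≤-reflexive; ≤-trans; ≰⇒>; m≤m+n; m+[n∸m]≡n; m⊓n≤m; m⊓n+n∸m≡n; m≤n+o⇒m∸n≤o;
         n≤0⇒n≡0; m^n≢0)
open import Algebra.Properties.CommutativeMonoid.Sum +-0-commutativeMonoid using (sum; ∑-comm)
open import Algebra.Properties.CommutativeSemigroup +-commutativeSemigroup using (xy∙z≈xz∙y)
open import Data.Product using (_×_; _,_; ∃-syntax; proj₁; proj₂; swap)
open import Data.Sum using (inj₁; inj₂) renaming (swap to ⊎-swap)
open import Data.Vec.Functional using (_∷_)
open import Function using (_∘_)
open import Relation.Nullary using (¬_; Dec; does; yes; no)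
open import Relation.Nullary.Decidable using (dec-true; dec-false)
open import Relation.Binary using (DecidableEquality)
open import Relation.Binary.PropositionalEquality
open import Relation.Binary.Construct.Closure.ReflexiveTransitive using (Star; ε; _◅_; _◅◅_; gmap)

open ≡-Reasoning

sumFin-cong : ∀ m {f g : Fin m → ℕ} → (∀ i → f i ≡ g i) → sumFin m f ≡ sumFin m g
sumFin-cong zero    f≗g = refl
sumFin-cong (suc m) f≗g = cong₂ _+_ (f≗g zero) (sumFin-cong m (f≗g ∘ suc))

sumFin-zero : ∀ m {f : Fin m → ℕ} → (∀ i → f i ≡ 0) → sumFin m f ≡ 0
sumFin-zero zero    f≗0 = refl
sumFin-zero (suc m) f≗0 = cong₂ _+_ (f≗0 zero) (sumFin-zero m (f≗0 ∘ suc))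

sumFin-δ : ∀ m (i : Fin m) {f : Fin m → ℕ} → (∀ j → j ≢ i → f j ≡ 0) → sumFin m f ≡ f i
sumFin-δ (suc m) zero    {f} off =
  trans (cong (f zero +_) (sumFin-zero m (λ j → off (suc j) λ ()))) (+-identityʳ (f zero))
sumFin-δ (suc m) (suc i)     off =
  cong₂ _+_ (off zero λ ()) (sumFin-δ m i (λ j j≢i → off (suc j) (j≢i ∘ suc-injective)))

sumFin-split : ∀ m (i : Fin m) (f : Fin m → ℕ) →
  sumFin m f ≡ sumFin m (λ j → if does (j ≟ i) then 0 else f j) + f i
sumFin-split (suc m) zero    f = +-comm (f zero) _
sumFin-split (suc m) (suc i) f =
  trans (cong (f zero +_) (sumFin-split m i (f ∘ suc))) (sym (+-assoc (f zero) _ (f (suc i))))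

sumFin≡sum : ∀ m (f : Fin m → ℕ) → sumFin m f ≡ sum f
sumFin≡sum zero    f = refl
sumFin≡sum (suc m) f = cong (f zero +_) (sumFin≡sum m (f ∘ suc))

sumFin-comm : ∀ m k (h : Fin m → Fin k → ℕ) →
  sumFin m (λ i → sumFin k (h i)) ≡ sumFin k (λ j → sumFin m (λ i → h i j))
sumFin-comm m k h = begin
  sumFin m (λ i → sumFin k (h i))          ≡⟨ sumFin-cong m (λ i → sumFin≡sum k (h i)) ⟩
  sumFin m (λ i → sum (h i))               ≡⟨ sumFin≡sum m _ ⟩
  sum (λ i → sum (h i))                    ≡⟨ ∑-comm h ⟩
  sum (λ j → sum (λ i → h i j))            ≡⟨ sumFin≡sum k _ ⟨
  sumFin k (λ j → sum (λ i → h i j))       ≡⟨ sumFin-cong k (λ j → sumFin≡sum m (λ i → h i j)) ⟨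
  sumFin k (λ j → sumFin m (λ i → h i j))  ∎

sumFin-truncate : ∀ m (f : Fin m → ℕ) {k} → k ≤ sumFin m f →
  ∃[ g ] ((∀ i → g i ≤ f i) × sumFin m g ≡ k)
sumFin-truncate zero    f k≤0 = (λ ()) , (λ ()) , sym (n≤0⇒n≡0 k≤0)
sumFin-truncate (suc m) f {k} k≤Σf
  with sumFin-truncate m (f ∘ suc) (m≤n+o⇒m∸n≤o k (f zero) k≤Σf)
... | g , g≤f , Σg≡k∸f₀ =
  f zero ⊓ k ∷ g ,
  (λ { zero → m⊓n≤m (f zero) k ; (suc i) → g≤f i }) ,
  trans (cong (f zero ⊓ k +_) Σg≡k∸f₀) (m⊓n+n∸m≡n (f zero) k)

infixl 7 _/2^_

_/2^_ : ℕ → ℕ → ℕ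
a /2^ k = _/_ a (2 ^ k) {{m^n≢0 2 k}}

/2^-zero : ∀ a → a /2^ 0 ≡ a
/2^-zero = n/1≡n

/2/2^ : ∀ a k → a / 2 /2^ k ≡ a /2^ suc k
/2/2^ a k = m/n/o≡m/[n*o] a 2 (2 ^ k) {{_}} {{m^n≢0 2 k}} {{m^n≢0 2 (suc k)}}

stack-zero : ∀ K s → stack K s 0 ≡ tot K s
stack-zero K s = sumFin-cong (n K) (/2^-zero ∘ s)

module Pebbling {X : Set} (_≟X_ : DecidableEquality X) (A : X → X → Set) where

  infix  4 _≤ᶜ_ _⟶_ _⟶*_ _↝_
  infixl 6 _+ᶜ_

  _≤ᶜ_ : Config X → Config X → Set
  c ≤ᶜ d = ∀ w → c w ≤ d w

  _+ᶜ_ : Config X → Config X → Config X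
  (c +ᶜ d) w = c w + d w

  single : X → ℕ → Config X
  single p a w = if does (w ≟X p) then a else 0

  _⟶_ : Config X → Config X → Set
  _⟶_ = Move _≟X_ A

  _⟶*_ : Config X → Config X → Set
  _⟶*_ = Star _⟶_

  _↝_ : Config X → Config X → Set
  c ↝ e = ∃[ c′ ] (c ⟶* c′ × e ≤ᶜ c′)

  single-at : ∀ p a → single p a p ≡ a
  single-at p a rewrite dec-true (p ≟X p) refl = refl

  single-off : ∀ {a} p w → w ≢ p → single p a w ≡ 0
  single-off p w w≢p rewrite dec-false (w ≟X p) w≢p = refl

  single-zero : ∀ p w → single p 0 w ≡ 0
  single-zero p w with does (w ≟X p)
  ... | true  = refl
  ... | false = refl

  single-+ : ∀ p a b w → single p (a + b) w ≡ single p a w + single p b w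
  single-+ p a b w with does (w ≟X p)
  ... | true  = refl
  ... | false = refl

  single-sum : ∀ p m (a : Fin m → ℕ) w →
    single p (sumFin m a) w ≡ sumFin m (λ i → single p (a i) w)
  single-sum p m a w with does (w ≟X p)
  ... | true  = refl
  ... | false = sym (sumFin-zero m (λ _ → refl))

  single-mono : ∀ p {a b} → a ≤ b → single p a ≤ᶜ single p b
  single-mono p a≤b w with does (w ≟X p)
  ... | true  = a≤b
  ... | false = z≤n

  ⟶-respˡ : ∀ {c d c′} → (∀ w → c w ≡ d w) → c ⟶ c′ → d ⟶ c′
  ⟶-respˡ c≗d (u , v , uv , two , moved) =
    u , v , uv , subst (2 ≤_) (c≗d u) two , λ w → trans (moved w) (cong (_+ _) (c≗d w))

  ⟶-frame : ∀ f {c c′} → c ⟶ c′ → c +ᶜ f ⟶ c′ +ᶜ f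
  ⟶-frame f {c} {c′} (u , v , uv , two , moved) =
    u , v , uv , ≤-trans two (m≤m+n (c u) (f u)) , λ w → begin
      c′ w + f w + single u 2 w  ≡⟨ xy∙z≈xz∙y (c′ w) (f w) _ ⟩
      c′ w + single u 2 w + f w  ≡⟨ cong (_+ f w) (moved w) ⟩
      c w + single v 1 w + f w   ≡⟨ xy∙z≈xz∙y (c w) _ (f w) ⟩
      c w + f w + single v 1 w   ∎

  ⟶*-frame : ∀ f {c c′} → c ⟶* c′ → c +ᶜ f ⟶* c′ +ᶜ f
  ⟶*-frame f = gmap (_+ᶜ f) (⟶-frame f)

  ⟶*-monotone : ∀ {c c′ d} → c ⟶* c′ → c ≤ᶜ d → ∃[ d′ ] (d ⟶* d′ × c′ ≤ᶜ d′)
  ⟶*-monotone {d = d} ε c≤d = d , ε , c≤d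
  ⟶*-monotone {c} {d = d} (_◅_ {j = c₁} c⟶c₁ c₁⟶*c′) c≤d
    with ⟶*-monotone c₁⟶*c′ (λ w → m≤m+n (c₁ w) (d w ∸ c w))
  ... | d′ , d₁⟶*d′ , c′≤d′ =
    d′ , ⟶-respˡ (λ w → m+[n∸m]≡n (c≤d w)) (⟶-frame (λ w → d w ∸ c w) c⟶c₁) ◅ d₁⟶*d′ , c′≤d′

  ≤ᶜ⇒↝ : ∀ {c e} → e ≤ᶜ c → c ↝ e
  ≤ᶜ⇒↝ {c} e≤c = c , ε , e≤c

  ⟶⇒↝ : ∀ {c e} → c ⟶ e → c ↝ e
  ⟶⇒↝ {e = e} c⟶e = e , c⟶e ◅ ε , λ _ → ≤-refl

  ↝-trans : ∀ {c d e} → c ↝ d → d ↝ e → c ↝ e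
  ↝-trans (c′ , c⟶*c′ , d≤c′) (d′ , d⟶*d′ , e≤d′) with ⟶*-monotone d⟶*d′ d≤c′
  ... | c″ , c′⟶*c″ , d′≤c″ = c″ , c⟶*c′ ◅◅ c′⟶*c″ , λ w → ≤-trans (e≤d′ w) (d′≤c″ w)

  ↝-resp-≤ᶜ : ∀ {c c₂ e e₂} → c ≤ᶜ c₂ → e₂ ≤ᶜ e → c ↝ e → c₂ ↝ e₂
  ↝-resp-≤ᶜ c≤c₂ e₂≤e c↝e = ↝-trans (≤ᶜ⇒↝ c≤c₂) (↝-trans c↝e (≤ᶜ⇒↝ e₂≤e))

  ↝-frame : ∀ f {c e} → c ↝ e → c +ᶜ f ↝ e +ᶜ f
  ↝-frame f (c′ , c⟶*c′ , e≤c′) = c′ +ᶜ f , ⟶*-frame f c⟶*c′ , λ w → +-monoˡ-≤ (f w) (e≤c′ w)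

  ↝-+ : ∀ {c₁ c₂ e₁ e₂} → c₁ ↝ e₁ → c₂ ↝ e₂ → c₁ +ᶜ c₂ ↝ e₁ +ᶜ e₂
  ↝-+ {c₂ = c₂} {e₁} {e₂} c₁↝e₁ c₂↝e₂ =
    ↝-trans (↝-frame c₂ c₁↝e₁)
      (↝-resp-≤ᶜ (λ w → ≤-reflexive (+-comm (c₂ w) (e₁ w))) (λ w → ≤-reflexive (+-comm (e₁ w) (e₂ w)))
        (↝-frame e₁ c₂↝e₂))

  ↝-sum : ∀ m {P Q : Fin m → Config X} → (∀ i → P i ↝ Q i) →
    (λ w → sumFin m (λ i → P i w)) ↝ (λ w → sumFin m (λ i → Q i w))
  ↝-sum zero    _   = ≤ᶜ⇒↝ (λ _ → z≤n)
  ↝-sum (suc m) P↝Q = ↝-+ (P↝Q zero) (↝-sum m (P↝Q ∘ suc))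

  ↝-solvable : ∀ {c e r} → c ↝ e → Solvable _≟X_ A e r → Solvable _≟X_ A c r
  ↝-solvable c↝e (e′ , e⟶*e′ , hit) with ↝-trans c↝e (e′ , e⟶*e′ , λ _ → ≤-refl)
  ... | c′ , c⟶*c′ , e′≤c′ = c′ , c⟶*c′ , ≤-trans hit (e′≤c′ _)

  single-⟶ : ∀ {u v} → A u v → single u 2 ⟶ single v 1
  single-⟶ {u} {v} uv =
    u , v , uv , ≤-reflexive (sym (single-at u 2)) , λ w → +-comm (single v 1 w) (single u 2 w)

  single-pairs-↝ : ∀ {u v} → A u v → ∀ k → single u (k * 2) ↝ single v k
  single-pairs-↝ {u} {v} uv zero =
    ≤ᶜ⇒↝ (λ w → ≤-reflexive (trans (single-zero v w) (sym (single-zero u w))))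
  single-pairs-↝ {u} {v} uv (suc k) =
    ↝-resp-≤ᶜ (≤-reflexive ∘ sym ∘ single-+ u 2 (k * 2)) (≤-reflexive ∘ single-+ v 1 k)
      (↝-+ (⟶⇒↝ (single-⟶ uv)) (single-pairs-↝ uv k))

  single-halve-↝ : ∀ {u v} → A u v → ∀ a → single u a ↝ single v (a / 2)
  single-halve-↝ {u} uv a =
    ↝-resp-≤ᶜ (single-mono u (m/n*n≤m a 2)) (λ _ → ≤-refl) (single-pairs-↝ uv (a / 2))

Pebbles-mono : ∀ G {p k} → Pebbles G p → p ≤ k → Pebbles G k
Pebbles-mono G pebbles p≤k f size≡k r with sumFin-truncate (n G) f (subst (_ ≤_) (sym size≡k) p≤k)
... | g , g≤f , size-g = ↝-solvable (≤ᶜ⇒↝ g≤f) (pebbles g size-g r)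
  where open Pebbling _≟_ (Adj G)

module Product (G H : Graph) where

  module Pᴳ = Pebbling _≟_ (Adj G)
  open Pebbling (G ≟× H) (AdjProd G H)

  embed : V H → Config (V G) → Config (V G × V H)
  embed r f (y , k) = if does (k ≟ r) then f y else 0

  embed-at : ∀ r f y → embed r f (y , r) ≡ f y
  embed-at r f y rewrite dec-true (r ≟ r) refl = refl

  embed-off : ∀ {r k} f y → k ≢ r → embed r f (y , k) ≡ 0
  embed-off {r} {k} f y k≢r rewrite dec-false (k ≟ r) k≢r = refl

  embed-single : ∀ r u a w → single (u , r) a w ≡ embed r (Pᴳ.single u a) w
  embed-single r u a (y , k) with y ≟ u | k ≟ r
  ... | yes refl | yes refl = refl
  ... | yes refl | no _     = refl
  ... | no _     | yes refl = refl
  ... | no _     | no _     = refl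

  embed-≡-sum : ∀ r f w → embed r f w ≡ sumFin (n G) (λ x → single (x , r) (f x) w)
  embed-≡-sum r f (y , k) = by-cases (k ≟ r)
    where
    by-cases : Dec (k ≡ r) → embed r f (y , k) ≡ sumFin (n G) (λ x → single (x , r) (f x) (y , k))
    by-cases (yes refl) = begin
      embed k f (y , k)             ≡⟨ embed-at k f y ⟩
      f y                           ≡⟨ single-at (y , k) (f y) ⟨
      single (y , k) (f y) (y , k)
        ≡⟨ sumFin-δ (n G) y (λ x x≢y → single-off (x , k) (y , k) (x≢y ∘ sym ∘ cong proj₁)) ⟨
      sumFin (n G) (λ x → single (x , k) (f x) (y , k)) ∎
    by-cases (no k≢r) = begin
      embed r f (y , k)  ≡⟨ embed-off f y k≢r ⟩
      0                  ≡⟨ sumFin-zero (n G) (λ x → single-off (x , r) (y , k) (k≢r ∘ cong proj₂)) ⟨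
      sumFin (n G) (λ x → single (x , r) (f x) (y , k)) ∎

  embed-⟶ : ∀ r {a b} → a Pᴳ.⟶ b → embed r a ⟶ embed r b
  embed-⟶ r {a} {b} (u , v , uv , two , moved) =
    (u , r) , (v , r) , inj₂ (refl , uv) , subst (2 ≤_) (sym (embed-at r a u)) two , embedded
    where
    embedded : ∀ w → embed r b w + single (u , r) 2 w ≡ embed r a w + single (v , r) 1 w
    embedded (y , k) rewrite embed-single r u 2 (y , k) | embed-single r v 1 (y , k) with k ≟ r
    ... | yes refl = moved y
    ... | no _     = refl

  embed-solvable : ∀ {f rG rH} → SolvableG G f rG → SolvableProd G H (embed rH f) (rG , rH)
  embed-solvable {rG = rG} {rH} (f′ , f⟶*f′ , hit) =
    embed rH f′ , gmap (embed rH) (embed-⟶ rH) f⟶*f′ , subst (1 ≤_) (sym (embed-at rH f′ rG)) hit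

  sum-of-singles : ∀ (c : Config (V G × V H)) w →
    sumFin (n G) (λ x → sumFin (n H) (λ j → single (x , j) (c (x , j)) w)) ≡ c w
  sum-of-singles c (y , k) = begin
    sumFin (n G) (λ x → sumFin (n H) (λ j → single (x , j) (c (x , j)) (y , k)))
      ≡⟨ sumFin-δ (n G) y (λ x x≢y →
           sumFin-zero (n H) (λ j → single-off (x , j) (y , k) (x≢y ∘ sym ∘ cong proj₁))) ⟩
    sumFin (n H) (λ j → single (y , j) (c (y , j)) (y , k))
      ≡⟨ sumFin-δ (n H) k (λ j j≢k → single-off (y , j) (y , k) (j≢k ∘ sym ∘ cong proj₂)) ⟩
    single (y , k) (c (y , k)) (y , k)
      ≡⟨ single-at (y , k) _ ⟩
    c (y , k) ∎

  walk-↝ : ∀ {j r k} → Walk H j r k → ∀ x a → single (x , j) a ↝ single (x , r) (a /2^ k)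
  walk-↝ here x a = ≤ᶜ⇒↝ (single-mono _ (≤-reflexive (/2^-zero a)))
  walk-↝ (step {k = k} jw w⇝r) x a =
    ↝-trans (single-halve-↝ (inj₁ (refl , jw)) a)
      (↝-resp-≤ᶜ (λ _ → ≤-refl) (single-mono _ (≤-reflexive (sym (/2/2^ a k)))) (walk-↝ w⇝r x (a / 2)))

  collapse : V H → (V H → ℕ) → Config (V G × V H) → Config (V G)
  collapse r d c x = sumFin (n H) (λ j → c (x , j) /2^ d j)

  collapse-↝ : ∀ {r d} → (∀ j → Walk H j r (d j)) → ∀ c → c ↝ embed r (collapse r d c)
  collapse-↝ {r} {d} walks c =
    ↝-resp-≤ᶜ (≤-reflexive ∘ sum-of-singles c) target-≤
      (↝-sum (n G) λ x → ↝-sum (n H) λ j → walk-↝ (walks j) x (c (x , j)))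
    where
    target-≤ : ∀ w → embed r (collapse r d c) w ≤
                     sumFin (n G) (λ x → sumFin (n H) (λ j → single (x , r) (c (x , j) /2^ d j) w))
    target-≤ w = ≤-reflexive (trans (embed-≡-sum r (collapse r d c) w)
                   (sumFin-cong (n G) λ x → single-sum (x , r) (n H) _ w))

  collapse-size : ∀ {r d} → d r ≡ 0 → ∀ c →
    size G (collapse r d c) ≡
    sumFin (n H) (λ j → if does (j ≟ r) then 0 else stack G (sliceG G H c j) (d j)) + tot G (sliceG G H c r)
  collapse-size {r} {d} dr≡0 c = begin
    size G (collapse r d c)                             ≡⟨ sumFin-comm (n G) (n H) _ ⟩
    sumFin (n H) (λ j → stack G (sliceG G H c j) (d j)) ≡⟨ sumFin-split (n H) r _ ⟩
    off-root + stack G (sliceG G H c r) (d r)           ≡⟨ cong ((off-root +_) ∘ stack G _) dr≡0 ⟩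
    off-root + stack G (sliceG G H c r) 0               ≡⟨ cong (off-root +_) (stack-zero G _) ⟩
    off-root + tot G (sliceG G H c r)                   ∎
    where
    off-root = sumFin (n H) (λ j → if does (j ≟ r) then 0 else stack G (sliceG G H c j) (d j))

  unsolvable⇒Bound : (rG : V G) (rH : V H) (c : Config (V G × V H)) →
    ¬ SolvableProd G H c (rG , rH) →
    (dH : V H → ℕ) → (∀ j → IsDistance H j rH (dH j)) →
    (pG : ℕ) → IsPebblingNumber G pG → Bound G H (sliceG G H c) rH dH pG
  unsolvable⇒Bound rG rH c unsolvable dH distance pG (pebbles , _) =
    subst (_≤ pG) (+-comm 1 _) (≰⇒> λ pG≤B → unsolvable
      (↝-solvable (collapse-↝ (proj₁ ∘ distance) c)
        (embed-solvable (Pebbles-mono G pebbles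
          (≤-trans pG≤B (≤-reflexive (sym (collapse-size {d = dH} dr≡0 c)))) _ refl rG))))
    where
    dr≡0 : dH rH ≡ 0
    dr≡0 = n≤0⇒n≡0 (proj₂ (distance rH) 0 here)

swap-solvable : ∀ G H {c r} → SolvableProd H G (c ∘ swap) (swap r) → SolvableProd G H c r
swap-solvable G H (d , steps , hit) = d ∘ swap , gmap (_∘ swap) swap-⟶ steps , hit
  where
  ≟×-swap : ∀ p q → does ((G ≟× H) p q) ≡ does ((H ≟× G) (swap p) (swap q))
  ≟×-swap (g , h) (g′ , h′) with g ≟ g′ | h ≟ h′
  ... | yes refl | yes refl = refl
  ... | yes refl | no _     = refl
  ... | no _     | yes refl = refl
  ... | no _     | no _     = refl

  swap-⟶ : ∀ {a b} → Move (H ≟× G) (AdjProd H G) a b →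
           Move (G ≟× H) (AdjProd G H) (a ∘ swap) (b ∘ swap)
  swap-⟶ (u , v , uv , two , moved) = swap u , swap v , ⊎-swap uv , two , λ w →
    subst₂ (λ s t → _ + (if s then 2 else 0) ≡ _ + (if t then 1 else 0))
      (sym (≟×-swap w (swap u))) (sym (≟×-swap w (swap v))) (moved (swap w))

theorem8 : (G H : Graph) → Connected G → Connected H →
    (rG : V G) (rH : V H) (c : Config (V G × V H)) →
    ¬ SolvableProd G H c (rG , rH) →
    -- K = G, K̄ = H
    ((dH : V H → ℕ) → (∀ j → IsDistance H j rH (dH j)) →
      (pG : ℕ) → IsPebblingNumber G pG →
      Bound G H (sliceG G H c) rH dH pG)
    ×
    -- K = H, K̄ = G
    ((dG : V G → ℕ) → (∀ j → IsDistance G j rG (dG j)) →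
      (pH : ℕ) → IsPebblingNumber H pH →
      Bound H G (sliceH G H c) rG dG pH)
theorem8 G H _ _ rG rH c unsolvable =
  Product.unsolvable⇒Bound G H rG rH c unsolvable ,
  Product.unsolvable⇒Bound H G rH rG (c ∘ swap) (unsolvable ∘ swap-solvable G H)
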